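{- Let $G$ be a graph with maximum degree at most $K\delta$ which does not contain $H$ as a subgraph, and let $t=|V(F)|$. Then for any $v\in V(G)$ and any $1\leq \ell\leq k$, the graph $\mathcal{G}_{\ell}(v)$ is $K_t$-free. Moreover, letting $r=R_k(t)$ be the $k$-colour Ramsey number of $K_t$, the graph $\mathcal{G}(v)$ is $K_r$-free.
   Context: Fix an integer $k\geq 1$, a multigraph $F$, $H=F^{2k-1}$ (the graph obtained from $F$ by replacing its edges with pairwise internally vertex-disjoint paths of length $2k$), and positive reals $K,\delta$. For $x\in V(G)$ and an integer $i\ge 0$, $\mathcal{P}_i(x)$ is the set of directed paths of length $i$ starting at $x$, and for $P\in\mathcal{P}_i(x)$, $v(P)$ is its endpoint. For nonnegative integers $i,j$ with $i+j<2k$, a pair $(x,y)$ of distinct vertices is $(i,j)$-rich if the number of pairs $(P,Q)\in \mathcal{P}_i(x)\times \mathcal{P}_j(y)$ such that there are at least $(|V(H)|+2)(2k+1)+1$ pairwise internally vertex-disjoint paths of length $2k-i-j$ between $v(P)$ and $v(Q)$ is more than $(2(i+j)|V(H)|(2k+1)+2(i+1)j)(K\delta)^{i+j-1}$; otherwise (including when $x=y$) it is $(i,j)$-poor. For $v\in V(G)$ and $1\le \ell\le k$, the auxiliary graph $\mathcal{G}_\ell(v)$ has as vertices the $(k+1)$-tuples $(u_0,u_1,\dots,u_k)\in V(G)^{k+1}$ with $u_0=v$ and $u_iu_{i+1}\in E(G)$ for all $0\le i\le k-1$; two vertices $(u_0,\dots,u_k)$ and $(u'_0,\dots,u'_k)$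 are adjacent if $v,u_1,\dots,u_k,u'_1,\dots,u'_k$ are distinct and there exist $0\leq i,j\leq k-1$ such that $(u_\ell,u'_\ell)$ is $(i,j)$-rich. $\mathcal{G}(v)=\bigcup_{1\le\ell\le k}\mathcal{G}_\ell(v)$ (all on the same vertex set).
   Formalization: The parameters K and δ range over the positive rationals instead of the positive reals. -}

module Defs where

open import Data.Nat as ℕ using (ℕ; zero; suc; _∸_; _≤_; _<_)
open import Data.Fin using (Fin; toℕ; inject₁; fromℕ) renaming (suc to fsuc; zero to fzero)
open import Data.Bool using (Bool; true; false)
open import Data.Product using (Σ; ∃; ∃-syntax; _×_; _,_; proj₁; proj₂)
open import Data.Sum using (_⊎_; inj₁; inj₂)
open import Data.List as List using (List; length; filterᵇ; allFin)
open import Data.List.Relation.Unary.All using (All)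
open import Data.List.Relation.Unary.AllPairs using (AllPairs)
open import Data.List.Relation.Unary.Unique.Propositional using (Unique)
open import Data.Vec as Vec using (Vec; lookup; _++_; tail)
open import Data.Integer as ℤ using (ℤ)
open import Data.Rational as ℚ using (ℚ; Positive; 1/_; _*_)
open import Data.Rational.Properties using (pos⇒nonZero; pos*pos⇒pos)
open import Relation.Binary.PropositionalEquality using (_≡_; _≢_)
open import Relation.Nullary using (¬_)

ℕ→ℚ : ℕ → ℚ
ℕ→ℚ n = ℤ.+ n ℚ./ 1

_^ℚ_ : ℚ → ℕ → ℚ
q ^ℚ zero  = ℚ.1ℚ
q ^ℚ suc e = q * (q ^ℚ e)

-- powPred D pD e = D^(e-1)   (exponent may be -1, hence D > 0 is needed)
powPred : (D : ℚ) → Positive D → ℕ → ℚ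
powPred D pD zero    = (1/ D) {{pos⇒nonZero D {{pD}}}}
powPred D pD (suc e) = D ^ℚ e

posMul : (K δ : ℚ) → Positive K → Positive δ → Positive (K * δ)
posMul K δ pK pδ = pos*pos⇒pos K {{pK}} δ {{pδ}}

record SimpleGraph (n : ℕ) : Set where
  field
    adj    : Fin n → Fin n → Bool
    sym    : ∀ u v → adj u v ≡ adj v u
    irrefl : ∀ v → adj v v ≡ false
open SimpleGraph public

Adj : {n : ℕ} → SimpleGraph n → Fin n → Fin n → Set
Adj G u v = adj G u v ≡ true

degree : {n : ℕ} → SimpleGraph n → Fin n → ℕ
degree {n} G v = length (filterᵇ (adj G v) (allFin n))

MaxDegreeAtMost : {n : ℕ} → SimpleGraph n → ℚ → Set
MaxDegreeAtMost G D = ∀ v → ℕ→ℚ (degree G v) ℚ.≤ D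

-- Paths.  A path of length i is a vector w_0,...,w_i of distinct vertices
-- with consecutive ones adjacent; it is directed from w_0 to w_i.

IsPath : {n : ℕ} → SimpleGraph n → (i : ℕ) → Vec (Fin n) (suc i) → Set
IsPath G i w =
  (∀ p q → lookup w p ≡ lookup w q → p ≡ q) ×
  (∀ (p : Fin i) → Adj G (lookup w (inject₁ p)) (lookup w (fsuc p)))

start : {n i : ℕ} → Vec (Fin n) (suc i) → Fin n
start w = lookup w fzero

end : {n i : ℕ} → Vec (Fin n) (suc i) → Fin n
end {i = i} w = lookup w (fromℕ i)

PathFrom : {n : ℕ} → SimpleGraph n → (i : ℕ) → Fin n → Vec (Fin n) (suc i) → Set
PathFrom G i x w = IsPath G i w × start w ≡ x

PathBetween : {n : ℕ} → SimpleGraph n → (L : ℕ) → Fin n → Fin n → Vec (Fin n) (suc L) → Set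
PathBetween G L a b w = IsPath G L w × start w ≡ a × end w ≡ b

Interior : {L : ℕ} → Fin (suc L) → Set
Interior {L} p = toℕ p ≢ 0 × toℕ p ≢ L

InternallyDisjoint : {n L : ℕ} → Vec (Fin n) (suc L) → Vec (Fin n) (suc L) → Set
InternallyDisjoint P Q =
  P ≢ Q × (∀ p q → Interior p → Interior q → lookup P p ≢ lookup Q q)

ManyPaths : {n : ℕ} → SimpleGraph n → (M L : ℕ) → Fin n → Fin n → Set
ManyPaths {n} G M L a b =
  Σ (List (Vec (Fin n) (suc L))) λ Ps →
    All (PathBetween G L a b) Ps × AllPairs InternallyDisjoint Ps × M ≤ length Ps

record Multigraph : Set where
  field
    t      : ℕ
    m      : ℕ
    ends   : Fin m → Fin t × Fin t
    noLoop : ∀ e → proj₁ (ends e) ≢ proj₂ (ends e)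
open Multigraph public

-- vertices of H: original vertices, plus 2k-1 subdivision vertices per edge
VH : Multigraph → ℕ → Set
VH F k = Fin (t F) ⊎ (Fin (m F) × Fin (2 ℕ.* k ∸ 1))

vH : Multigraph → ℕ → ℕ
vH F k = t F ℕ.+ m F ℕ.* (2 ℕ.* k ∸ 1)

-- edge e = ab becomes the path a, (e,0), (e,1), ..., (e,2k-2), b
data HAdj (F : Multigraph) (k : ℕ) : VH F k → VH F k → Set where
  first : ∀ e p → toℕ p ≡ 0 → HAdj F k (inj₁ (proj₁ (ends F e))) (inj₂ (e , p))
  mid   : ∀ e p q → suc (toℕ p) ≡ toℕ q → HAdj F k (inj₂ (e , p)) (inj₂ (e , q))
  last  : ∀ e p → toℕ p ≡ 2 ℕ.* k ∸ 2 → HAdj F k (inj₂ (e , p)) (inj₁ (proj₂ (ends F e)))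

ContainsSubdivision : {n : ℕ} → SimpleGraph n → Multigraph → ℕ → Set
ContainsSubdivision {n} G F k =
  Σ (VH F k → Fin n) λ f →
    (∀ x y → f x ≡ f y → x ≡ y) × (∀ x y → HAdj F k x y → Adj G (f x) (f y))

module _ {n : ℕ} (G : SimpleGraph n) (F : Multigraph) (k : ℕ)
         (D : ℚ) (pD : Positive D) where   -- D = Kδ

  numPaths : ℕ
  numPaths = (vH F k ℕ.+ 2) ℕ.* (2 ℕ.* k ℕ.+ 1) ℕ.+ 1

  threshold : ℕ → ℕ → ℚ
  threshold i j =
    ℕ→ℚ (2 ℕ.* (i ℕ.+ j) ℕ.* vH F k ℕ.* (2 ℕ.* k ℕ.+ 1) ℕ.+ 2 ℕ.* (i ℕ.+ 1) ℕ.* j)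
      * powPred D pD (i ℕ.+ j)

  GoodPair : (i j : ℕ) → Fin n → Fin n → Vec (Fin n) (suc i) × Vec (Fin n) (suc j) → Set
  GoodPair i j x y (P , Q) =
    PathFrom G i x P × PathFrom G j y Q ×
    ManyPaths G numPaths (2 ℕ.* k ∸ (i ℕ.+ j)) (end P) (end Q)

  -- (x,y) is (i,j)-rich: x ≠ y and the number of good pairs (P,Q) exceeds
  -- the threshold (witnessed by a duplicate-free list of good pairs)
  Rich : (i j : ℕ) → Fin n → Fin n → Set
  Rich i j x y =
    x ≢ y ×
    Σ (List (Vec (Fin n) (suc i) × Vec (Fin n) (suc j))) λ Ls →
      Unique Ls × All (GoodPair i j x y) Ls × threshold i j ℚ.< ℕ→ℚ (length Ls)

  Tuple : Fin n → Set
  Tuple v = Σ (Vec (Fin n) (suc k)) λ U →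
    lookup U fzero ≡ v × (∀ (p : Fin k) → Adj G (lookup U (inject₁ p)) (lookup U (fsuc p)))

  -- v,u_1..u_k,u'_1..u'_k distinct, and (u_ℓ,u'_ℓ) is (i,j)-rich for some i,j ≤ k-1
  AdjCond : (v : Fin n) → Fin (suc k) → Tuple v → Tuple v → Set
  AdjCond v ℓ (U , _) (U' , _) =
    (∀ p q → lookup (U ++ tail U') p ≡ lookup (U ++ tail U') q → p ≡ q) ×
    ∃[ i ] ∃[ j ] (i < k × j < k × Rich i j (lookup U ℓ) (lookup U' ℓ))

  𝒢Adj : (v : Fin n) → Fin (suc k) → Tuple v → Tuple v → Set
  𝒢Adj v ℓ U U' = AdjCond v ℓ U U' ⊎ AdjCond v ℓ U' U

  𝒢AdjAll : (v : Fin n) → Tuple v → Tuple v → Set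
  𝒢AdjAll v U U' = ∃[ ℓ ] (1 ≤ toℕ ℓ × 𝒢Adj v ℓ U U')

CliqueFree : {V : Set} → (V → V → Set) → ℕ → Set
CliqueFree {V} R s =
  ¬ (Σ (Fin s → V) λ c → (∀ p q → c p ≡ c q → p ≡ q) × (∀ p q → p ≢ q → R (c p) (c q)))

RamseyProperty : (k t r : ℕ) → Set
RamseyProperty k t r =
  (c : Fin r → Fin r → Fin k) → (∀ a b → c a b ≡ c b a) →
  Σ (Fin k) λ col → Σ (Fin t → Fin r) λ g →
    (∀ p q → g p ≡ g q → p ≡ q) × (∀ p q → p ≢ q → c (g p) (g q) ≡ col)

IsRamseyNumber : (k t r : ℕ) → Set
IsRamseyNumber k t r = RamseyProperty k t r × (∀ r' → RamseyProperty k t r' → r ≤ r')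

{-# OPTIONS --safe #-}
-- A clique in 𝒢_ℓ(v) gives t vertices x_a (the ℓ-th entries of its tuples), any two of which form a
-- rich pair in one order or the other.  H is embedded greedily with the x_a as branch vertices: the
-- edges of F are handled one at a time, each by a path of length 2k between its ends that avoids the
-- at most |V(H)| vertices used so far.  For a rich pair (x, y) and such a set S, a pair (P, Q) of
-- paths from x and y is unusable only when P or Q meets S or Q meets P; counting walks in a graph of
-- maximum degree Δ ≤ Kδ bounds the unusable pairs by (|S| i + (|S| + i + 1) j) Δ^(i+j-1), which is
-- below the richness threshold.  For a usable pair, each vertex of S ∪ P ∪ Q lies inside at most one
-- of the internally disjoint paths between the ends of P and Q, so one of them completes an x–y path
-- of length 2k.  For 𝒢(v), colouring each edge of a K_r by a layer ℓ containing it yields, by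
-- Ramsey's theorem, a K_t inside a single 𝒢_ℓ(v).
module Submission where

open import Defs hiding (sym)
open import Data.Nat as ℕ using (ℕ; zero; suc; _+_; _*_; _^_; _∸_; _≤_; _<_; z≤n; s≤s)
import Data.Nat.Properties as ℕ
import Data.Nat.Coprimality as Coprimality
open import Data.Nat.Solver using (module +-*-Solver)
import Data.Integer as ℤ
import Data.Integer.Properties as ℤ
open import Data.Rational as ℚ using (ℚ; mkℚ; Positive; NonNegative)
import Data.Rational.Properties as ℚ
open import Data.Fin as Fin using (Fin; zero; suc; toℕ; inject₁; fromℕ)
import Data.Fin.Properties as Fin
open import Data.Bool using (T; T?)
open import Data.Unit using (tt)
open import Data.List as List using (List; []; _∷_; _++_; length; map; concat; concatMap; reverse; tabulate; filter)
import Data.List.Properties as List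
open import Data.List.Membership.Propositional using (_∈_; _∉_; find)
open import Data.List.Membership.Propositional.Properties
open import Data.List.Relation.Unary.Any as Any using (Any; here; there)
import Data.List.Relation.Unary.Any.Properties as Any
open import Data.List.Relation.Unary.All as All using (All; []; _∷_)
import Data.List.Relation.Unary.All.Properties as All
open import Data.List.Relation.Unary.AllPairs as AllPairs using (AllPairs; []; _∷_)
import Data.List.Relation.Unary.AllPairs.Properties as AllPairs
open import Data.List.Relation.Unary.Unique.Propositional using (Unique)
import Data.List.Relation.Unary.Unique.Propositional.Properties as Unique
open import Data.List.Relation.Binary.Disjoint.Propositional using (Disjoint)
open import Data.Vec as Vec using (Vec; []; _∷_; lookup; toList; tail)
import Data.Vec.Properties as Vec
open import Data.Product as Product using (Σ; ∃-syntax; _×_; _,_; proj₁; proj₂)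
open import Data.Product.Properties using (,-injective)
open import Data.Sum as Sum using (_⊎_; inj₁; inj₂; [_,_]′)
open import Data.Empty using (⊥-elim)
open import Function using (id; _∘_)
open import Relation.Binary.Definitions using (DecidableEquality; tri<; tri≈; tri>)
open import Relation.Binary.PropositionalEquality using (_≡_; _≢_; refl; sym; trans; cong; cong₂; subst; module ≡-Reasoning)
open import Relation.Nullary using (¬_; Dec; yes; no)
open import Relation.Nullary.Decidable using (¬?; _×-dec_; decidable-stable)

private variable
  A B : Set

Unique⇒length≤ : {xs ys : List A} → Unique xs → (∀ {z} → z ∈ xs → z ∈ ys) → length xs ≤ length ys
Unique⇒length≤ {xs = []} _ _ = z≤n
Unique⇒length≤ {xs = x ∷ xs} {ys} (x≢xs ∷ u) xs⊆ys with ∈-∃++ (xs⊆ys (here refl))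
... | us , vs , refl = begin
  suc (length xs)              ≤⟨ s≤s (Unique⇒length≤ u xs⊆us++vs) ⟩
  suc (length (us ++ vs))      ≡⟨ cong suc (List.length-++ us) ⟩
  suc (length us + length vs)  ≡⟨ ℕ.+-suc (length us) (length vs) ⟨
  length us + length (x ∷ vs)  ≡⟨ List.length-++ us ⟨
  length (us ++ x ∷ vs)        ∎
  where
  open ℕ.≤-Reasoning
  xs⊆us++vs : ∀ {z} → z ∈ xs → z ∈ us ++ vs
  xs⊆us++vs {z} z∈xs with ∈-++⁻ us (xs⊆ys (there z∈xs))
  ... | inj₁ z∈us         = ∈-++⁺ˡ z∈us
  ... | inj₂ (here refl)  = ⊥-elim (All.lookup x≢xs z∈xs refl)
  ... | inj₂ (there z∈vs) = ∈-++⁺ʳ us z∈vs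

length-concatMap≤ : (f : A → List B) (xs : List A) {b : ℕ} →
  All (λ x → length (f x) ≤ b) xs → length (concatMap f xs) ≤ length xs * b
length-concatMap≤ f [] [] = z≤n
length-concatMap≤ f (x ∷ xs) (fx≤b ∷ fxs≤b) = begin
  length (f x ++ concatMap f xs)          ≡⟨ List.length-++ (f x) ⟩
  length (f x) + length (concatMap f xs)  ≤⟨ ℕ.+-mono-≤ fx≤b (length-concatMap≤ f xs fxs≤b) ⟩
  _ + length xs * _                       ∎
  where open ℕ.≤-Reasoning

pairs : List A → (A → List B) → List (A × B)
pairs xs f = concatMap (λ x → map (x ,_) (f x)) xs

length-pairs≤ : (xs : List A) (f : A → List B) {b : ℕ} →
  All (λ x → length (f x) ≤ b) xs → length (pairs xs f) ≤ length xs * b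
length-pairs≤ xs f fxs≤b =
  length-concatMap≤ _ xs (All.map (λ {x} → ℕ.≤-trans (ℕ.≤-reflexive (List.length-map (x ,_) (f x)))) fxs≤b)

∈-pairs⁺ : {xs : List A} {f : A → List B} {x : A} {y : B} → x ∈ xs → y ∈ f x → (x , y) ∈ pairs xs f
∈-pairs⁺ x∈xs y∈fx = ∈-concatMap⁺ _ (Any.map (λ { refl → ∈-map⁺ (_ ,_) y∈fx }) x∈xs)

Unique-reverse : {xs : List A} → Unique xs → Unique (reverse xs)
Unique-reverse {xs = []} [] = []
Unique-reverse {xs = x ∷ xs} (x≢xs ∷ u) = subst Unique (sym (List.unfold-reverse x xs))
  (Unique.++⁺ (Unique-reverse u) ([] ∷ []) λ { (x∈ , here refl) → All.lookup x≢xs (Any.reverse⁻ x∈) refl })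

All-reverse : {P : A → Set} {xs : List A} → All P xs → All P (reverse xs)
All-reverse pxs = All.tabulate (All.lookup pxs ∘ Any.reverse⁻)

Unique⇒lookup-injective : {xs : List A} → Unique xs → ∀ {p q} → List.lookup xs p ≡ List.lookup xs q → p ≡ q
Unique⇒lookup-injective (_ ∷ _) {zero} {zero} _ = refl
Unique⇒lookup-injective (x≢xs ∷ _) {zero} {suc q} eq = ⊥-elim (All.lookup x≢xs (∈-lookup q) eq)
Unique⇒lookup-injective (x≢xs ∷ _) {suc p} {zero} eq = ⊥-elim (All.lookup x≢xs (∈-lookup p) (sym eq))
Unique⇒lookup-injective (_ ∷ u) {suc p} {suc q} eq = cong suc (Unique⇒lookup-injective u eq)

module _ (_≟_ : DecidableEquality A) where
  open import Data.List.Membership.DecPropositional _≟_ using (_∈?_)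

  at-most-one-contains : (z : A) {xss : List (List A)} → AllPairs Disjoint xss →
    length xss ≤ suc (length (filter (λ ws → ¬? (z ∈? ws)) xss))
  at-most-one-contains z [] = z≤n
  at-most-one-contains z {ws ∷ xss} (ws#xss ∷ disj) with z ∈? ws
  ... | yes z∈ws rewrite List.filter-all (λ ws → ¬? (z ∈? ws))
                           (All.map (λ ws#vs z∈vs → ws#vs (z∈ws , z∈vs)) ws#xss) = ℕ.≤-refl
  ... | no _ = s≤s (at-most-one-contains z disj)

  -- Each z ∈ X lies in at most one of the lists, so discarding those containing z loses at most one.
  avoiding-member : {xss : List (List A)} → AllPairs Disjoint xss → (X : List A) →
    length X < length xss → ∃[ ws ] (ws ∈ xss × All (_∉ X) ws)
  avoiding-member {ws ∷ _} _ [] _ = ws , here refl , All.tabulate (λ _ ())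
  avoiding-member {xss} disj (z ∷ X) X<xss
    with avoiding-member (AllPairs.filter⁺ (λ ws → ¬? (z ∈? ws)) disj) X
           (ℕ.≤-pred (ℕ.≤-trans X<xss (at-most-one-contains z disj)))
  ... | ws , ws∈ , ws∉X with ∈-filter⁻ (λ ws → ¬? (z ∈? ws)) ws∈
  ...   | ws∈xss , z∉ws = ws , ws∈xss , All.tabulate (λ w∈ws → avoid w∈ws (All.lookup ws∉X w∈ws))
    where
    avoid : ∀ {w} → w ∈ ws → w ∉ X → w ∉ z ∷ X
    avoid w∈ws _ (here refl) = z∉ws w∈ws
    avoid _ w∉X (there w∈X) = w∉X w∈X

DisjointChoice : ∀ {A : Set} {m} → (Fin m → List A → Set) → List A → ℕ → Set
DisjointChoice {A} {m} Good S₀ c = Σ (Fin m → List A) λ W →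
  (∀ e → Good e (W e) × All (_∉ S₀) (W e) × length (W e) ≡ c) × (∀ e e′ → e ≢ e′ → Disjoint (W e) (W e′))

length-concat-tabulate : ∀ {m c} (W : Fin m → List A) → (∀ e → length (W e) ≡ c) →
  length (concat (tabulate W)) ≡ m * c
length-concat-tabulate {m = zero}  W |W| = refl
length-concat-tabulate {m = suc m} W |W| =
  trans (List.length-++ (W zero)) (cong₂ _+_ (|W| zero) (length-concat-tabulate (W ∘ suc) (|W| ∘ suc)))

-- Choose the lists one at a time, each avoiding S₀ and all earlier choices.
greedy : ∀ m (Good : Fin m → List A → Set) (S₀ : List A) (c : ℕ) →
  (∀ e S → length S ≤ length S₀ + m * c → ∃[ ws ] (Good e ws × All (_∉ S) ws × length ws ≡ c)) →
  DisjointChoice Good S₀ c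
greedy zero    Good S₀ c choose = (λ ()) , (λ ()) , λ ()
greedy (suc m) Good S₀ c choose =
  extend (greedy m (Good ∘ suc) S₀ c λ e S |S|≤ → choose (suc e) S (ℕ.≤-trans |S|≤ room))
  where
  room : length S₀ + m * c ≤ length S₀ + suc m * c
  room = ℕ.+-monoʳ-≤ (length S₀) (ℕ.m≤n+m (m * c) c)
  extend : DisjointChoice (Good ∘ suc) S₀ c → DisjointChoice Good S₀ c
  extend (W , chosen , disjoint)
    with choose zero (S₀ ++ concat (tabulate W))
           (ℕ.≤-trans (ℕ.≤-reflexive (trans (List.length-++ S₀)
             (cong (length S₀ +_) (length-concat-tabulate W (λ e → proj₂ (proj₂ (chosen e))))))) room)
  ... | ws , good , ws∉S , |ws| = W′ , chosen′ , disjoint′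
    where
    W′ : Fin (suc m) → List _
    W′ zero    = ws
    W′ (suc e) = W e
    chosen′ : ∀ e → Good e (W′ e) × All (_∉ S₀) (W′ e) × length (W′ e) ≡ c
    chosen′ zero    = good , All.map (_∘ ∈-++⁺ˡ) ws∉S , |ws|
    chosen′ (suc e) = chosen e
    ws#W : ∀ e → Disjoint ws (W e)
    ws#W e (z∈ws , z∈We) = All.lookup ws∉S z∈ws (∈-++⁺ʳ S₀ (∈-concat⁺′ z∈We (∈-tabulate⁺ e)))
    disjoint′ : ∀ e e′ → e ≢ e′ → Disjoint (W′ e) (W′ e′)
    disjoint′ zero    zero     e≢e′ = ⊥-elim (e≢e′ refl)
    disjoint′ zero    (suc e′) _    = ws#W e′
    disjoint′ (suc e) zero     _    = λ (z∈We , z∈ws) → ws#W e (z∈ws , z∈We)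
    disjoint′ (suc e) (suc e′) e≢e′ = disjoint e e′ (e≢e′ ∘ cong suc)

module _ {A : Set} (R : A → A → Set) where

  -- Walk x zs y: the walk x ∷ zs, whose last vertex is y (so y = x when zs is empty).
  data Walk : A → List A → A → Set where
    []  : ∀ {x} → Walk x [] x
    _∷_ : ∀ {x y z zs} → R x y → Walk y zs z → Walk x (y ∷ zs) z

  -- Route x ws y: the walk x ∷ ws ++ y ∷ [] of length at least one; ws are its interior vertices.
  data Route : A → List A → A → Set where
    [_] : ∀ {x y} → R x y → Route x [] y
    _∷_ : ∀ {x y z ws} → R x y → Route y ws z → Route x (y ∷ ws) z

module _ {A : Set} {R : A → A → Set} where

  _◅◅_ : ∀ {x y z zs ws} → Walk R x zs y → Route R y ws z → Route R x (zs ++ ws) z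
  []       ◅◅ route = route
  (r ∷ rs) ◅◅ route = r ∷ (rs ◅◅ route)

  _⁀_ : ∀ {x y z ws vs} → Route R x ws y → Route R y vs z → Route R x (ws ++ y ∷ vs) z
  [ r ]    ⁀ route = r ∷ route
  (r ∷ rs) ⁀ route = r ∷ (rs ⁀ route)

  module _ (R-sym : ∀ {x y} → R x y → R y x) where

    reverseRoute : ∀ {x y ws} → Route R x ws y → Route R y (reverse ws) x
    reverseRoute [ r ] = [ R-sym r ]
    reverseRoute {x} {ws = w ∷ ws} (r ∷ rs) =
      subst (λ vs → Route R _ vs x) (sym (List.unfold-reverse w ws)) (reverseRoute rs ⁀ [ R-sym r ])

    splice : ∀ {x p q y ps ms qs} → Walk R x ps p → Route R p ms q → Walk R y qs q →
      Route R x (ps ++ ms ++ reverse qs) y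
    splice {y = y} {ps} {ms} {qs} P M Q = subst (λ vs → Route R _ vs y) reversed
      (reverseRoute (Q ◅◅ reverseRoute (P ◅◅ M)))
      where
      open ≡-Reasoning
      reversed : reverse (qs ++ reverse (ps ++ ms)) ≡ ps ++ ms ++ reverse qs
      reversed = begin
        reverse (qs ++ reverse (ps ++ ms))           ≡⟨ List.reverse-++ qs (reverse (ps ++ ms)) ⟩
        reverse (reverse (ps ++ ms)) ++ reverse qs   ≡⟨ cong (_++ reverse qs) (List.reverse-involutive (ps ++ ms)) ⟩
        (ps ++ ms) ++ reverse qs                     ≡⟨ List.++-assoc ps ms (reverse qs) ⟩
        ps ++ ms ++ reverse qs                       ∎

  route-first : ∀ {x y ws} → Route R x ws y → (p : Fin (length ws)) → toℕ p ≡ 0 → R x (List.lookup ws p)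
  route-first (r ∷ _) zero _ = r

  route-next : ∀ {x y ws} → Route R x ws y → (p q : Fin (length ws)) → suc (toℕ p) ≡ toℕ q →
    R (List.lookup ws p) (List.lookup ws q)
  route-next (_ ∷ rs) zero (suc q) eq = route-first rs q (sym (ℕ.suc-injective eq))
  route-next (_ ∷ rs) (suc p) (suc q) eq = route-next rs p q (ℕ.suc-injective eq)

  route-last : ∀ {x y ws} → Route R x ws y → (p : Fin (length ws)) → suc (toℕ p) ≡ length ws →
    R (List.lookup ws p) y
  route-last (_ ∷ [ r ]) zero _ = r
  route-last (_ ∷ (_ ∷ _)) zero ()
  route-last (_ ∷ rs) (suc p) eq = route-last rs p (ℕ.suc-injective eq)

interior : ∀ {L} → Vec A (suc (suc L)) → List A
interior (_ ∷ _ ∷ []) = []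
interior (_ ∷ b ∷ c ∷ w) = b ∷ interior (b ∷ c ∷ w)

module _ {A : Set} {R : A → A → Set} where

  walkOfVec : ∀ {i} (w : Vec A (suc i)) → (∀ (p : Fin i) → R (lookup w (inject₁ p)) (lookup w (suc p))) →
    Walk R (lookup w zero) (toList (tail w)) (lookup w (fromℕ i))
  walkOfVec (_ ∷ []) _ = []
  walkOfVec (_ ∷ _ ∷ w) adj = adj zero ∷ walkOfVec (_ ∷ w) (adj ∘ suc)

  routeOfVec : ∀ {L} (w : Vec A (suc (suc L))) →
    (∀ (p : Fin (suc L)) → R (lookup w (inject₁ p)) (lookup w (suc p))) →
    Route R (lookup w zero) (interior w) (lookup w (fromℕ (suc L)))
  routeOfVec (_ ∷ _ ∷ []) adj = [ adj zero ]
  routeOfVec (_ ∷ _ ∷ _ ∷ w) adj = adj zero ∷ routeOfVec (_ ∷ _ ∷ w) (adj ∘ suc)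

∈-interior⁻ : ∀ {L} {z : A} (w : Vec A (suc (suc L))) → z ∈ interior w →
  ∃[ p ] (Interior {suc L} p × lookup w p ≡ z)
∈-interior⁻ (_ ∷ _ ∷ _ ∷ _) (here refl) = suc zero , ((λ ()) , (λ ())) , refl
∈-interior⁻ (_ ∷ _ ∷ c ∷ w) (there z∈) with ∈-interior⁻ (_ ∷ c ∷ w) z∈
... | p , (p≢0 , p≢L) , eq = suc p , ((λ ()) , p≢L ∘ ℕ.suc-injective) , eq

length-interior : ∀ {L} (w : Vec A (suc (suc L))) → length (interior w) ≡ L
length-interior (_ ∷ _ ∷ []) = refl
length-interior (_ ∷ _ ∷ c ∷ w) = cong suc (length-interior (_ ∷ c ∷ w))

Distinct : ∀ {m} → Vec A m → Set
Distinct w = ∀ p q → lookup w p ≡ lookup w q → p ≡ q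

Unique-interior : ∀ {L} (w : Vec A (suc (suc L))) → Distinct w → Unique (interior w)
Unique-interior (_ ∷ _ ∷ []) _ = []
Unique-interior (a ∷ b ∷ c ∷ w) inj = All.tabulate b∉ ∷ Unique-interior (b ∷ c ∷ w) inj′
  where
  inj′ : Distinct (b ∷ c ∷ w)
  inj′ p q eq = Fin.suc-injective (inj (suc p) (suc q) eq)
  b∉ : ∀ {z} → z ∈ interior (b ∷ c ∷ w) → b ≢ z
  b∉ z∈ b≡z with ∈-interior⁻ (b ∷ c ∷ w) z∈
  ... | p , (p≢0 , _) , eq = p≢0 (cong toℕ (inj′ p zero (trans eq (sym b≡z))))

toList≡tabulate : ∀ {m} (w : Vec A m) → toList w ≡ List.tabulate (lookup w)
toList≡tabulate [] = refl
toList≡tabulate (a ∷ w) = cong (a ∷_) (toList≡tabulate w)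

Unique-toList : ∀ {m} (w : Vec A m) → Distinct w → Unique (toList w)
Unique-toList w inj = subst Unique (sym (toList≡tabulate w)) (Unique.tabulate⁺ (inj _ _))

toList-injective : ∀ {m} {v w : Vec A m} → toList v ≡ toList w → v ≡ w
toList-injective {v = []} {[]} _ = refl
toList-injective {v = a ∷ v} {b ∷ w} eq =
  cong₂ _∷_ (List.∷-injectiveˡ eq) (toList-injective (List.∷-injectiveʳ eq))

Clear : List A → ∀ {i j} → Vec A (suc i) × Vec A (suc j) → Set
Clear S (P , Q) = All (_∉ S) (toList (tail P)) × All (_∉ S ++ toList P) (toList (tail Q))

module WalkCount {n : ℕ} (G : SimpleGraph n) (Δ : ℕ) (deg≤Δ : ∀ v → degree G v ≤ Δ) where

  open import Data.List.Membership.DecPropositional (Fin._≟_ {n}) using (_∈?_)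

  neighbours : Fin n → List (Fin n)
  neighbours x = List.filterᵇ (adj G x) (List.allFin n)

  ∈-neighbours⁺ : ∀ {x y} → Adj G x y → y ∈ neighbours x
  ∈-neighbours⁺ {x} {y} xy = ∈-filter⁺ (T? ∘ adj G x) (∈-allFin y) (subst T (sym xy) tt)

  walks : Fin n → ℕ → List (List (Fin n))
  walks x zero    = (x ∷ []) ∷ []
  walks x (suc m) = map (x ∷_) (concatMap (λ y → walks y m) (neighbours x))

  -- Contains every walk of length m from x meeting S after x, and some non-walks too:
  -- the step into S is not checked for adjacency, which keeps the count simple.
  hits : List (Fin n) → Fin n → ℕ → List (List (Fin n))
  hits S x zero    = []
  hits S x (suc m) = map (x ∷_) (concatMap (λ z → walks z m) S ++ concatMap (λ y → hits S y m) (neighbours x))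

  walks-complete : ∀ {x y zs m} → Walk (Adj G) x zs y → length zs ≡ m → x ∷ zs ∈ walks x m
  walks-complete []       refl = here refl
  walks-complete (xy ∷ w) refl =
    ∈-map⁺ _ (∈-concatMap⁺ _ (Any.map (λ { refl → walks-complete w refl }) (∈-neighbours⁺ xy)))

  hits-complete : ∀ {S x y zs m} → Walk (Adj G) x zs y → length zs ≡ m → Any (_∈ S) zs → x ∷ zs ∈ hits S x m
  hits-complete (_ ∷ w) refl (here z∈S) =
    ∈-map⁺ _ (∈-++⁺ˡ (∈-concatMap⁺ _ (Any.map (λ { refl → walks-complete w refl }) z∈S)))
  hits-complete (xy ∷ w) refl (there hit) =
    ∈-map⁺ _ (∈-++⁺ʳ _ (∈-concatMap⁺ _ (Any.map (λ { refl → hits-complete w refl hit }) (∈-neighbours⁺ xy))))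

  length-walks : ∀ x m → length (walks x m) ≤ Δ ^ m
  length-walks x zero    = ℕ.≤-refl
  length-walks x (suc m) = begin
    length (map (x ∷_) (concatMap (λ y → walks y m) (neighbours x)))
      ≡⟨ List.length-map (x ∷_) (concatMap (λ y → walks y m) (neighbours x)) ⟩
    length (concatMap (λ y → walks y m) (neighbours x))
      ≤⟨ length-concatMap≤ (λ y → walks y m) (neighbours x) (All.tabulate λ {y} _ → length-walks y m) ⟩
    degree G x * Δ ^ m
      ≤⟨ ℕ.*-monoˡ-≤ _ (deg≤Δ x) ⟩
    Δ * Δ ^ m ∎
    where open ℕ.≤-Reasoning

  walks-length : ∀ x m → All (λ p → length p ≡ suc m) (walks x m)
  walks-length x zero    = refl ∷ []
  walks-length x (suc m) =
    All.map⁺ (All.concat⁺ (All.map⁺ {xs = neighbours x}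
      (All.tabulate λ {y} _ → All.map (cong suc) (walks-length y m))))

  length-hits : ∀ S x m → length (hits S x m) ≤ length S * (m * Δ ^ (m ∸ 1))
  length-hits S x zero    = z≤n
  length-hits S x (suc m) = begin
    length (map (x ∷_) (concatMap (λ z → walks z m) S ++ concatMap (λ y → hits S y m) (neighbours x)))
      ≡⟨ trans (List.length-map (x ∷_) (concatMap (λ z → walks z m) S ++ _))
               (List.length-++ (concatMap (λ z → walks z m) S)) ⟩
    length (concatMap (λ z → walks z m) S) + length (concatMap (λ y → hits S y m) (neighbours x))
      ≤⟨ ℕ.+-mono-≤ (length-concatMap≤ (λ z → walks z m) S (All.tabulate λ {z} _ → length-walks z m))
                    (length-concatMap≤ (λ y → hits S y m) (neighbours x) (All.tabulate λ {y} _ → length-hits S y m)) ⟩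
    length S * Δ ^ m + degree G x * (length S * (m * Δ ^ (m ∸ 1)))
      ≤⟨ ℕ.+-monoʳ-≤ (length S * Δ ^ m) (ℕ.*-monoˡ-≤ _ (deg≤Δ x)) ⟩
    length S * Δ ^ m + Δ * (length S * (m * Δ ^ (m ∸ 1)))
      ≡⟨ cong (λ e → length S * Δ ^ m + e) (shift m) ⟩
    length S * Δ ^ m + length S * (m * Δ ^ m)
      ≡⟨ ℕ.*-distribˡ-+ (length S) (Δ ^ m) (m * Δ ^ m) ⟨
    length S * (suc m * Δ ^ m) ∎
    where
    open ℕ.≤-Reasoning
    open +-*-Solver
    shift : ∀ m → Δ * (length S * (m * Δ ^ (m ∸ 1))) ≡ length S * (m * Δ ^ m)
    shift zero    = trans (cong (Δ *_) (ℕ.*-zeroʳ (length S)))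
                          (trans (ℕ.*-zeroʳ Δ) (sym (ℕ.*-zeroʳ (length S))))
    shift (suc m) = solve 4 (λ d s m p → d :* (s :* ((con 1 :+ m) :* p)) := s :* ((con 1 :+ m) :* (d :* p)))
                      refl Δ (length S) m (Δ ^ m)

  blocked : List (Fin n) → Fin n → Fin n → ℕ → ℕ → List (List (Fin n) × List (Fin n))
  blocked S x y i j = pairs (hits S x i) (λ _ → walks y j) ++ pairs (walks x i) (λ p → hits (S ++ p) y j)

  blocked-complete : ∀ {S x y p q ps qs i j} →
    Walk (Adj G) x ps p → length ps ≡ i → Walk (Adj G) y qs q → length qs ≡ j →
    ¬ (All (_∉ S) ps × All (_∉ S ++ x ∷ ps) qs) → (x ∷ ps , y ∷ qs) ∈ blocked S x y i j
  blocked-complete {S} {x} {ps = ps} {qs} P |P| Q |Q| unclear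
    with Any.any? (_∈? S) ps | Any.any? (_∈? S ++ x ∷ ps) qs
  ... | yes hitP | _        = ∈-++⁺ˡ (∈-pairs⁺ (hits-complete P |P| hitP) (walks-complete Q |Q|))
  ... | no _     | yes hitQ = ∈-++⁺ʳ _ (∈-pairs⁺ (walks-complete P |P|) (hits-complete Q |Q| hitQ))
  ... | no missP | no missQ = ⊥-elim (unclear (All.¬Any⇒All¬ ps missP , All.¬Any⇒All¬ qs missQ))

  length-blocked : ∀ S x y i j →
    length (blocked S x y i j) ≤ (length S * i + (length S + suc i) * j) * Δ ^ (i + j ∸ 1)
  length-blocked S x y i j = begin
    length (blocked S x y i j)
      ≡⟨ List.length-++ (pairs (hits S x i) (λ _ → walks y j)) ⟩
    length (pairs (hits S x i) (λ _ → walks y j)) + length (pairs (walks x i) (λ p → hits (S ++ p) y j))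
      ≤⟨ ℕ.+-mono-≤ (length-pairs≤ (hits S x i) _ (All.tabulate λ _ → length-walks y j))
                    (length-pairs≤ (walks x i) _ (All.map hits≤ (walks-length x i))) ⟩
    length (hits S x i) * Δ ^ j + length (walks x i) * (s′ * (j * Δ ^ (j ∸ 1)))
      ≤⟨ ℕ.+-mono-≤ (ℕ.*-monoˡ-≤ _ (length-hits S x i)) (ℕ.*-monoˡ-≤ _ (length-walks x i)) ⟩
    length S * (i * Δ ^ (i ∸ 1)) * Δ ^ j + Δ ^ i * (s′ * (j * Δ ^ (j ∸ 1)))
      ≡⟨ solve 5 (λ s iA B C s′jD → s :* iA :* B :+ C :* s′jD := s :* (iA :* B) :+ C :* s′jD) refl
           (length S) (i * Δ ^ (i ∸ 1)) (Δ ^ j) (Δ ^ i) (s′ * (j * Δ ^ (j ∸ 1))) ⟩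
    length S * (i * Δ ^ (i ∸ 1) * Δ ^ j) + Δ ^ i * (s′ * (j * Δ ^ (j ∸ 1)))
      ≡⟨ cong₂ (λ u v → length S * u + v) (shiftˡ i) (swap-shiftʳ j) ⟩
    length S * (i * Δ ^ (i + j ∸ 1)) + s′ * (j * Δ ^ (i + j ∸ 1))
      ≡⟨ solve 5 (λ s i s′ j E → s :* (i :* E) :+ s′ :* (j :* E) := (s :* i :+ s′ :* j) :* E) refl
           (length S) i s′ j (Δ ^ (i + j ∸ 1)) ⟩
    (length S * i + s′ * j) * Δ ^ (i + j ∸ 1) ∎
    where
    open ℕ.≤-Reasoning
    open +-*-Solver
    s′ : ℕ
    s′ = length S + suc i
    hits≤ : ∀ {p} → length p ≡ suc i → length (hits (S ++ p) y j) ≤ s′ * (j * Δ ^ (j ∸ 1))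
    hits≤ {p} |p| = subst (λ l → length (hits (S ++ p) y j) ≤ l * (j * Δ ^ (j ∸ 1)))
      (trans (List.length-++ S) (cong (length S +_) |p|)) (length-hits (S ++ p) y j)
    shiftˡ : ∀ i → i * Δ ^ (i ∸ 1) * Δ ^ j ≡ i * Δ ^ (i + j ∸ 1)
    shiftˡ zero    = refl
    shiftˡ (suc i) = trans (ℕ.*-assoc (suc i) (Δ ^ i) (Δ ^ j))
                           (cong (suc i *_) (sym (ℕ.^-distribˡ-+-* Δ i j)))
    swap-shiftʳ : ∀ j → Δ ^ i * (s′ * (j * Δ ^ (j ∸ 1))) ≡ s′ * (j * Δ ^ (i + j ∸ 1))
    swap-shiftʳ zero    = trans (cong (Δ ^ i *_) (ℕ.*-zeroʳ s′))
                                (trans (ℕ.*-zeroʳ (Δ ^ i)) (sym (ℕ.*-zeroʳ s′)))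
    swap-shiftʳ (suc j) = begin-equality
      Δ ^ i * (s′ * (suc j * Δ ^ j))
        ≡⟨ solve 4 (λ A s j B → A :* (s :* ((con 1 :+ j) :* B)) := s :* ((con 1 :+ j) :* (A :* B)))
             refl (Δ ^ i) s′ j (Δ ^ j) ⟩
      s′ * (suc j * (Δ ^ i * Δ ^ j))
        ≡⟨ cong (λ e → s′ * (suc j * e)) (sym (ℕ.^-distribˡ-+-* Δ i j)) ⟩
      s′ * (suc j * Δ ^ (i + j))
        ≡⟨ cong (λ e → s′ * (suc j * Δ ^ (e ∸ 1))) (sym (ℕ.+-suc i j)) ⟩
      s′ * (suc j * Δ ^ (i + suc j ∸ 1)) ∎

  PathPair : ∀ i j → Fin n → Fin n → Vec (Fin n) (suc i) × Vec (Fin n) (suc j) → Set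
  PathPair i j x y (P , Q) = PathFrom G i x P × PathFrom G j y Q

  unclear-blocked : ∀ {S x y i j} {PQ : Vec (Fin n) (suc i) × Vec (Fin n) (suc j)} →
    PathPair i j x y PQ → ¬ Clear S PQ → Product.map toList toList PQ ∈ blocked S x y i j
  unclear-blocked {PQ = _ ∷ P , _ ∷ Q} (((_ , adjP) , refl) , ((_ , adjQ) , refl)) =
    blocked-complete (walkOfVec (_ ∷ P) adjP) (Vec.length-toList P)
                     (walkOfVec (_ ∷ Q) adjQ) (Vec.length-toList Q)

  clear? : ∀ S {i j} (PQ : Vec (Fin n) (suc i) × Vec (Fin n) (suc j)) → Dec (Clear S PQ)
  clear? S (P , Q) = All.all? (λ z → ¬? (z ∈? S)) _ ×-dec All.all? (λ z → ¬? (z ∈? S ++ toList P)) _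

  clear-pair : ∀ {S x y i j} {Ls : List (Vec (Fin n) (suc i) × Vec (Fin n) (suc j))} →
    Unique Ls → All (PathPair i j x y) Ls →
    (length S * i + (length S + suc i) * j) * Δ ^ (i + j ∸ 1) < length Ls → Any (Clear S) Ls
  clear-pair {S} {x} {y} {i} {j} {Ls} u paths many with Any.any? (clear? S) Ls
  ... | yes clear = clear
  ... | no none = ⊥-elim (ℕ.<⇒≱ many (begin
    length Ls                                        ≡⟨ List.length-map toLists Ls ⟨
    length (map toLists Ls)                          ≤⟨ Unique⇒length≤ (Unique.map⁺ toLists-injective u) ⊆blocked ⟩
    length (blocked S x y i j)                       ≤⟨ length-blocked S x y i j ⟩
    (length S * i + (length S + suc i) * j) * Δ ^ (i + j ∸ 1) ∎))
    where
    open ℕ.≤-Reasoning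
    toLists : Vec (Fin n) (suc i) × Vec (Fin n) (suc j) → List (Fin n) × List (Fin n)
    toLists = Product.map toList toList
    toLists-injective : ∀ {PQ P′Q′} → toLists PQ ≡ toLists P′Q′ → PQ ≡ P′Q′
    toLists-injective eq =
      cong₂ _,_ (toList-injective (proj₁ (,-injective eq))) (toList-injective (proj₂ (,-injective eq)))
    ⊆blocked : ∀ {z} → z ∈ map toLists Ls → z ∈ blocked S x y i j
    ⊆blocked z∈ with ∈-map⁻ toLists z∈
    ... | PQ , PQ∈Ls , refl =
      unclear-blocked (All.lookup paths PQ∈Ls) (All.lookup (All.¬Any⇒All¬ Ls none) PQ∈Ls)

ℕ→ℚ≡mkℚ : ∀ m → ℕ→ℚ m ≡ mkℚ (ℤ.+ m) 0 (Coprimality.sym (Coprimality.1-coprimeTo m))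
ℕ→ℚ≡mkℚ m = ℚ.normalize-coprime (Coprimality.sym (Coprimality.1-coprimeTo m))

ℕ→ℚ-* : ∀ a b → ℕ→ℚ (a * b) ≡ ℕ→ℚ a ℚ.* ℕ→ℚ b
ℕ→ℚ-* a b rewrite ℕ→ℚ≡mkℚ a | ℕ→ℚ≡mkℚ b = cong (ℚ._/ 1) (ℤ.pos-* a b)

ℕ→ℚ-mono-≤ : ∀ {a b} → a ≤ b → ℕ→ℚ a ℚ.≤ ℕ→ℚ b
ℕ→ℚ-mono-≤ {a} {b} a≤b rewrite ℕ→ℚ≡mkℚ a | ℕ→ℚ≡mkℚ b = ℚ.*≤* (ℤ.*-monoʳ-≤-nonNeg (ℤ.+ 1) (ℤ.+≤+ a≤b))

ℕ→ℚ-nonNeg : ∀ m → NonNegative (ℕ→ℚ m)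
ℕ→ℚ-nonNeg m = ℚ.nonNegative (ℕ→ℚ-mono-≤ {0} {m} z≤n)

module _ {D : ℚ} .{{_ : NonNegative D}} {Δ : ℕ} (Δ≤D : ℕ→ℚ Δ ℚ.≤ D) where

  ℕ→ℚ-^-≤ : ∀ e → ℕ→ℚ (Δ ^ e) ℚ.≤ D ^ℚ e
  ℕ→ℚ-^-≤ zero    = ℚ.≤-refl
  ℕ→ℚ-^-≤ (suc e) = begin
    ℕ→ℚ (Δ * Δ ^ e)          ≡⟨ ℕ→ℚ-* Δ (Δ ^ e) ⟩
    ℕ→ℚ Δ ℚ.* ℕ→ℚ (Δ ^ e)    ≤⟨ ℚ.*-monoʳ-≤-nonNeg (ℕ→ℚ (Δ ^ e)) {{ℕ→ℚ-nonNeg (Δ ^ e)}} Δ≤D ⟩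
    D ℚ.* ℕ→ℚ (Δ ^ e)        ≤⟨ ℚ.*-monoˡ-≤-nonNeg D (ℕ→ℚ-^-≤ e) ⟩
    D ℚ.* D ^ℚ e             ∎
    where open ℚ.≤-Reasoning

  ℕ→ℚ-*^-≤ : ∀ {c C} e → c ≤ C → ℕ→ℚ (c * Δ ^ e) ℚ.≤ ℕ→ℚ C ℚ.* D ^ℚ e
  ℕ→ℚ-*^-≤ {c} {C} e c≤C = begin
    ℕ→ℚ (c * Δ ^ e)          ≡⟨ ℕ→ℚ-* c (Δ ^ e) ⟩
    ℕ→ℚ c ℚ.* ℕ→ℚ (Δ ^ e)    ≤⟨ ℚ.*-monoʳ-≤-nonNeg (ℕ→ℚ (Δ ^ e)) {{ℕ→ℚ-nonNeg (Δ ^ e)}} (ℕ→ℚ-mono-≤ c≤C) ⟩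
    ℕ→ℚ C ℚ.* ℕ→ℚ (Δ ^ e)    ≤⟨ ℚ.*-monoˡ-≤-nonNeg (ℕ→ℚ C) {{ℕ→ℚ-nonNeg C}} (ℕ→ℚ-^-≤ e) ⟩
    ℕ→ℚ C ℚ.* D ^ℚ e         ∎
    where open ℚ.≤-Reasoning

module _ {n : ℕ} (G : SimpleGraph n) where
  open import Data.List.Extrema ℕ.≤-totalOrder using (max; xs≤max; argmax-all)

  maxDegree : ℕ
  maxDegree = max 0 (List.map (degree G) (List.allFin n))

  degree≤maxDegree : ∀ v → degree G v ≤ maxDegree
  degree≤maxDegree v = All.lookup (xs≤max 0 _) (∈-map⁺ (degree G) (∈-allFin v))

  maxDegree≤ : ∀ {D} .{{_ : NonNegative D}} → MaxDegreeAtMost G D → ℕ→ℚ maxDegree ℚ.≤ D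
  maxDegree≤ {D} maxDeg =
    argmax-all id {P = λ d → ℕ→ℚ d ℚ.≤ D} {0} {List.map (degree G) (List.allFin n)}
      (ℚ.nonNegative⁻¹ D) (All.map⁺ {f = degree G} (All.tabulate λ {v} _ → maxDeg v))

coefficient≤ : ∀ {s v} k i j → s ≤ v →
  s * i + (s + suc i) * j ≤ 2 * (i + j) * v * (2 * k + 1) + 2 * (i + 1) * j
coefficient≤ {s} {v} k i j s≤v = begin
  s * i + (s + suc i) * j                  ≡⟨ solve 4 (λ s i j v → s :* i :+ (s :+ (con 1 :+ i)) :* j
                                                 := (i :+ j) :* s :+ (con 1 :+ i) :* j) refl s i j v ⟩
  (i + j) * s + suc i * j                  ≤⟨ ℕ.+-monoˡ-≤ (suc i * j) (ℕ.*-monoʳ-≤ (i + j) s≤v) ⟩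
  (i + j) * v + suc i * j                  ≤⟨ ℕ.m≤m+n _ ((i + j) * v * (4 * k + 1) + suc i * j) ⟩
  (i + j) * v + suc i * j + ((i + j) * v * (4 * k + 1) + suc i * j)
    ≡⟨ solve 4 (λ i j v k → (i :+ j) :* v :+ (con 1 :+ i) :* j
                              :+ ((i :+ j) :* v :* (con 4 :* k :+ con 1) :+ (con 1 :+ i) :* j)
                            := con 2 :* (i :+ j) :* v :* (con 2 :* k :+ con 1) :+ con 2 :* (i :+ con 1) :* j)
         refl i j v k ⟩
  2 * (i + j) * v * (2 * k + 1) + 2 * (i + 1) * j ∎
  where
  open ℕ.≤-Reasoning
  open +-*-Solver

module _ {n : ℕ} (G : SimpleGraph n) (F : Multigraph) (k : ℕ) (D : ℚ) (pD : Positive D)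
         {Δ : ℕ} (Δ≤D : ℕ→ℚ Δ ℚ.≤ D) where

  private instance
    D-nonNeg : NonNegative D
    D-nonNeg = ℚ.pos⇒nonNeg D {{pD}}

  unclear≤threshold : ∀ {s} i j → s ≤ vH F k →
    ℕ→ℚ ((s * i + (s + suc i) * j) * Δ ^ (i + j ∸ 1)) ℚ.≤ threshold G F k D pD i j
  -- For i = j = 0 the threshold carries the factor (Kδ)⁻¹, but its coefficient is 0.
  unclear≤threshold {s} zero zero s≤v = begin
    ℕ→ℚ ((s * 0 + (s + 1) * 0) * 1)   ≡⟨ cong (λ c → ℕ→ℚ (c * 1)) (ℕ.n≤0⇒n≡0 (coefficient≤ k 0 0 s≤v)) ⟩
    ℚ.0ℚ                              ≡⟨ ℚ.*-zeroˡ (powPred D pD 0) ⟨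
    threshold G F k D pD 0 0          ∎
    where open ℚ.≤-Reasoning
  unclear≤threshold (suc i) j    s≤v = ℕ→ℚ-*^-≤ Δ≤D (i + j) (coefficient≤ k (suc i) j s≤v)
  unclear≤threshold zero (suc j) s≤v = ℕ→ℚ-*^-≤ Δ≤D j (coefficient≤ k 0 (suc j) s≤v)

∸≡suc∸suc : ∀ {a m} → a < m → m ∸ a ≡ suc (m ∸ suc a)
∸≡suc∸suc {zero}  {suc m} _          = refl
∸≡suc∸suc {suc a} {suc m} (s≤s a<m) = ∸≡suc∸suc a<m

spliced-length : ∀ i j {m} → i + j < m → i + (m ∸ suc (i + j) + j) ≡ m ∸ 1
spliced-length i j {suc m} (s≤s i+j≤m) = begin
  i + (m ∸ (i + j) + j)  ≡⟨ solve 3 (λ i j l → i :+ (l :+ j) := (i :+ j) :+ l) refl i j (m ∸ (i + j)) ⟩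
  i + j + (m ∸ (i + j))  ≡⟨ ℕ.m+[n∸m]≡n i+j≤m ⟩
  m                      ∎
  where
  open ≡-Reasoning
  open +-*-Solver

few-blockers : ∀ {s v i j k} → s ≤ v → i < k → j < k → s + (suc i + suc j) < (v + 2) * (2 * k + 1) + 1
few-blockers {s} {v} {i} {j} {k} s≤v i<k j<k = begin-strict
  s + (suc i + suc j)                     ≤⟨ ℕ.+-mono-≤ s≤v (ℕ.+-mono-≤ i<k j<k) ⟩
  v + (k + k)                             ≤⟨ ℕ.m≤m+n (v + (k + k)) (v * (2 * k) + 2 * k + 2) ⟩
  v + (k + k) + (v * (2 * k) + 2 * k + 2)
    ≡⟨ solve 2 (λ v k → v :+ (k :+ k) :+ (v :* (con 2 :* k) :+ con 2 :* k :+ con 2)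
                        := (v :+ con 2) :* (con 2 :* k :+ con 1)) refl v k ⟩
  (v + 2) * (2 * k + 1)                   <⟨ ℕ.m<m+n _ (s≤s z≤n) ⟩
  (v + 2) * (2 * k + 1) + 1               ∎
  where
  open ℕ.≤-Reasoning
  open +-*-Solver

module Paths {n : ℕ} (G : SimpleGraph n) where

  adj-sym : ∀ {x y} → Adj G x y → Adj G y x
  adj-sym {x} {y} xy = trans (SimpleGraph.sym G y x) xy

  AvoidingPath : List (Fin n) → ℕ → Fin n → Fin n → Set
  AvoidingPath S c x y = ∃[ ws ] ((Route (Adj G) x ws y × Unique ws) × All (_∉ S) ws × length ws ≡ c)

  reverseAvoidingPath : ∀ {S c x y} → AvoidingPath S c x y → AvoidingPath S c y x
  reverseAvoidingPath (ws , (route , unique) , ws∉S , |ws|) =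
    reverse ws , (reverseRoute adj-sym route , Unique-reverse unique) , All-reverse ws∉S ,
    trans (List.length-reverse ws) |ws|

  interiors-disjoint : ∀ {L} {M M′ : Vec (Fin n) (suc (suc L))} → InternallyDisjoint M M′ →
    Disjoint (interior M) (interior M′)
  interiors-disjoint {M = M} {M′} (_ , apart) (z∈M , z∈M′)
    with ∈-interior⁻ M z∈M | ∈-interior⁻ M′ z∈M′
  ... | p , p-inner , Mp≡z | q , q-inner , M′q≡z = apart p q p-inner q-inner (trans Mp≡z (sym M′q≡z))

  avoiding-of-many : ∀ {M L a b} (X : List (Fin n)) → length X < M → ManyPaths G M (suc L) a b →
    AvoidingPath X L a b
  avoiding-of-many X X<M (Ps , paths , disjoint , M≤Ps)
    with avoiding-member Fin._≟_ (AllPairs.map⁺ (AllPairs.map interiors-disjoint disjoint)) X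
           (ℕ.≤-trans X<M (ℕ.≤-trans M≤Ps (ℕ.≤-reflexive (sym (List.length-map interior Ps)))))
  ... | _ , ms∈ , ms∉X with ∈-map⁻ interior ms∈
  ...   | M , M∈Ps , refl with All.lookup paths M∈Ps
  ...     | (distinct , adjacent) , refl , refl =
    interior M , (routeOfVec M adjacent , Unique-interior M distinct) , ms∉X , length-interior M

  splice-avoiding : ∀ {S x y i j L} {P : Vec (Fin n) (suc i)} {Q : Vec (Fin n) (suc j)} →
    PathFrom G i x P → PathFrom G j y Q → Clear S (P , Q) →
    AvoidingPath (S ++ toList P ++ toList Q) L (end P) (end Q) → AvoidingPath S (i + (L + j)) x y
  splice-avoiding {S} {P = _ ∷ P′} {_ ∷ Q′} ((distinctP , adjP) , refl) ((distinctQ , adjQ) , refl)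
                  (ps∉S , qs∉SP) (ms , (route , ms-unique) , ms∉SPQ , |ms|) =
    ps ++ ms ++ reverse qs ,
    (splice adj-sym (walkOfVec (_ ∷ P′) adjP) route (walkOfVec (_ ∷ Q′) adjQ) ,
     Unique.++⁺ (Unique.drop⁺ 1 (Unique-toList (_ ∷ P′) distinctP))
                (Unique.++⁺ ms-unique
                            (Unique-reverse (Unique.drop⁺ 1 (Unique-toList (_ ∷ Q′) distinctQ))) ms#qs)
                ps#ms++qs) ,
    All.++⁺ ps∉S (All.++⁺ (All.map (_∘ ∈-++⁺ˡ) ms∉SPQ) (All-reverse (All.map (_∘ ∈-++⁺ˡ) qs∉SP))) ,
    length-spliced
    where
    ps = toList P′
    qs = toList Q′
    ms#qs : Disjoint ms (reverse qs)
    ms#qs (z∈ms , z∈qs) =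
      All.lookup ms∉SPQ z∈ms (∈-++⁺ʳ S (∈-++⁺ʳ (_ ∷ ps) (there (Any.reverse⁻ z∈qs))))
    ps#ms++qs : Disjoint ps (ms ++ reverse qs)
    ps#ms++qs (z∈ps , z∈ms++qs) with ∈-++⁻ ms z∈ms++qs
    ... | inj₁ z∈ms = All.lookup ms∉SPQ z∈ms (∈-++⁺ʳ S (∈-++⁺ˡ (there z∈ps)))
    ... | inj₂ z∈qs = All.lookup qs∉SP (Any.reverse⁻ z∈qs) (∈-++⁺ʳ S (there z∈ps))
    length-spliced : length (ps ++ ms ++ reverse qs) ≡ _
    length-spliced = begin
      length (ps ++ ms ++ reverse qs)                ≡⟨ List.length-++ ps ⟩
      length ps + length (ms ++ reverse qs)          ≡⟨ cong (length ps +_) (List.length-++ ms) ⟩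
      length ps + (length ms + length (reverse qs))
        ≡⟨ cong (λ l → length ps + (length ms + l)) (List.length-reverse qs) ⟩
      length ps + (length ms + length qs)
        ≡⟨ cong₃ (Vec.length-toList P′) |ms| (Vec.length-toList Q′) ⟩
      _                                              ∎
      where
      open ≡-Reasoning
      cong₃ : ∀ {a a′ b b′ c c′} → a ≡ a′ → b ≡ b′ → c ≡ c′ → a + (b + c) ≡ a′ + (b′ + c′)
      cong₃ refl refl refl = refl

module RichPairs {n : ℕ} (G : SimpleGraph n) (F : Multigraph) (k : ℕ) (D : ℚ) (pD : Positive D)
                 (maxDeg : MaxDegreeAtMost G D) where
  open WalkCount G (maxDegree G) (degree≤maxDegree G)
  open Paths G

  RichLink : Fin n → Fin n → Set
  RichLink x y = ∃[ i ] ∃[ j ] (i < k × j < k × Rich G F k D pD i j x y)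

  rich⇒avoidingPath : ∀ {x y} (S : List (Fin n)) → length S ≤ vH F k → RichLink x y →
    AvoidingPath S (2 * k ∸ 1) x y
  rich⇒avoidingPath {x} {y} S |S|≤v (i , j , i<k , j<k , _ , Ls , unique , goods , rich) =
    from-clear (find (clear-pair unique (All.map (λ (pathP , pathQ , _) → pathP , pathQ) goods) unclear<Ls))
    where
    i+j<2k : i + j < 2 * k
    i+j<2k = ℕ.≤-trans (ℕ.+-mono-< i<k j<k) (ℕ.≤-reflexive (cong (k +_) (sym (ℕ.+-identityʳ k))))
    unclear<Ls : (length S * i + (length S + suc i) * j) * maxDegree G ^ (i + j ∸ 1) < length Ls
    unclear<Ls = ℕ.≰⇒> λ Ls≤ → ℚ.<-irrefl refl (ℚ.≤-<-trans (ℚ.≤-trans (ℕ→ℚ-mono-≤ Ls≤)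
      (unclear≤threshold G F k D pD (maxDegree≤ G {{ℚ.pos⇒nonNeg D {{pD}}}} maxDeg) i j |S|≤v)) rich)
    from-clear : ∃[ PQ ] (PQ ∈ Ls × Clear S PQ) → AvoidingPath S (2 * k ∸ 1) x y
    from-clear ((P , Q) , PQ∈Ls , clear) with All.lookup goods PQ∈Ls
    ... | pathP , pathQ , middles =
      subst (λ c → AvoidingPath S c x y) (spliced-length i j i+j<2k)
        (splice-avoiding pathP pathQ clear
          (avoiding-of-many (S ++ toList P ++ toList Q)
            (ℕ.≤-trans (ℕ.≤-reflexive (cong suc |X|)) (few-blockers |S|≤v i<k j<k))
            (subst (λ L → ManyPaths G (numPaths G F k D pD) L (end P) (end Q)) (∸≡suc∸suc i+j<2k) middles)))
      where
      |X| : length (S ++ toList P ++ toList Q) ≡ length S + (suc i + suc j)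
      |X| = trans (List.length-++ S) (cong (length S +_)
              (trans (List.length-++ (toList P)) (cong₂ _+_ (Vec.length-toList P) (Vec.length-toList Q))))

module Embedding {n : ℕ} (G : SimpleGraph n) (F : Multigraph) (k : ℕ) (1≤k : 1 ≤ k)
                 (img : Fin (t F) → Fin n) (img-injective : ∀ a b → img a ≡ img b → a ≡ b)
                 (connect : ∀ a b → a ≢ b → ∀ S → length S ≤ vH F k →
                            Paths.AvoidingPath G S (2 * k ∸ 1) (img a) (img b)) where

  source target : Fin (m F) → Fin (t F)
  source e = proj₁ (ends F e)
  target e = proj₂ (ends F e)

  Branch : Fin (m F) → List (Fin n) → Set
  Branch e ws = Route (Adj G) (img (source e)) ws (img (target e)) × Unique ws

  branches : DisjointChoice Branch (tabulate img) (2 * k ∸ 1)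
  branches = greedy (m F) Branch (tabulate img) (2 * k ∸ 1) λ e S |S|≤ →
    connect (source e) (target e) (noLoop F e) S
      (subst (λ s → length S ≤ s + m F * (2 * k ∸ 1)) (List.length-tabulate img) |S|≤)

  module _ (W : Fin (m F) → List (Fin n))
           (chosen : ∀ e → Branch e (W e) × All (_∉ tabulate img) (W e) × length (W e) ≡ 2 * k ∸ 1)
           (disjoint : ∀ e e′ → e ≢ e′ → Disjoint (W e) (W e′)) where

    route : ∀ e → Route (Adj G) (img (source e)) (W e) (img (target e))
    route e = proj₁ (proj₁ (chosen e))

    position : ∀ e → Fin (2 * k ∸ 1) → Fin (length (W e))
    position e = Fin.cast (sym (proj₂ (proj₂ (chosen e))))

    f : VH F k → Fin n
    f (inj₁ a)       = img a
    f (inj₂ (e , p)) = List.lookup (W e) (position e p)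

    toℕ-position : ∀ e p → toℕ (position e p) ≡ toℕ p
    toℕ-position e = Fin.toℕ-cast _

    f-adjacent : ∀ u v → HAdj F k u v → Adj G (f u) (f v)
    f-adjacent _ _ (first e p p≡0) = route-first (route e) (position e p) (trans (toℕ-position e p) p≡0)
    f-adjacent _ _ (mid e p q p+1≡q) = route-next (route e) (position e p) (position e q)
      (trans (cong suc (toℕ-position e p)) (trans p+1≡q (sym (toℕ-position e q))))
    f-adjacent _ _ (last e p p≡2k∸2) = route-last (route e) (position e p) (begin
      suc (toℕ (position e p))  ≡⟨ cong suc (trans (toℕ-position e p) p≡2k∸2) ⟩
      suc (2 * k ∸ 2)           ≡⟨ ∸≡suc∸suc (ℕ.*-monoʳ-≤ 2 1≤k) ⟨
      2 * k ∸ 1                 ≡⟨ proj₂ (proj₂ (chosen e)) ⟨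
      length (W e)              ∎)
      where open ≡-Reasoning

    branch-avoids-img : ∀ e p a → f (inj₂ (e , p)) ≢ img a
    branch-avoids-img e p a eq =
      All.lookup (proj₁ (proj₂ (chosen e))) (∈-lookup _) (subst (_∈ tabulate img) (sym eq) (∈-tabulate⁺ a))

    f-injective : ∀ u v → f u ≡ f v → u ≡ v
    f-injective (inj₁ a)       (inj₁ b)        eq = cong inj₁ (img-injective a b eq)
    f-injective (inj₁ a)       (inj₂ (e , p))  eq = ⊥-elim (branch-avoids-img e p a (sym eq))
    f-injective (inj₂ (e , p)) (inj₁ a)        eq = ⊥-elim (branch-avoids-img e p a eq)
    f-injective (inj₂ (e , p)) (inj₂ (e′ , q)) eq with e Fin.≟ e′
    ... | yes refl = cong (λ p → inj₂ (e , p)) (Fin.toℕ-injective (begin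
      toℕ p             ≡⟨ toℕ-position e p ⟨
      toℕ (position e p) ≡⟨ cong toℕ (Unique⇒lookup-injective (proj₂ (proj₁ (chosen e))) eq) ⟩
      toℕ (position e q) ≡⟨ toℕ-position e q ⟩
      toℕ q             ∎))
      where open ≡-Reasoning
    ... | no e≢e′ = ⊥-elim (disjoint e e′ e≢e′ (∈-lookup _ , subst (_∈ W e′) (sym eq) (∈-lookup _)))

  subdivision : ContainsSubdivision G F k
  subdivision =
    let W , chosen , disjoint = branches
    in  f W chosen disjoint , f-injective W chosen disjoint , f-adjacent W chosen disjoint

module _ {V : Set} {k : ℕ} (R : Fin k → V → V → Set) (R-sym : ∀ l {u w} → R l u w → R l w u) where

  module Colouring {r : ℕ} (l₀ : Fin k) (c : Fin r → V) (edge : ∀ p q → p ≢ q → ∃[ l ] R l (c p) (c q)) where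

    ordered : ∀ p q → p Fin.< q → Fin k
    ordered p q p<q = proj₁ (edge p q (Fin.<⇒≢ p<q))

    -- Reading every edge from its smaller end makes the colouring symmetric.
    colour : Fin r → Fin r → Fin k
    colour p q with Fin.<-cmp p q
    ... | tri< p<q _ _ = ordered p q p<q
    ... | tri≈ _ _ _   = l₀
    ... | tri> _ _ q<p = ordered q p q<p

    colour-sym : ∀ p q → colour p q ≡ colour q p
    colour-sym p q with Fin.<-cmp p q | Fin.<-cmp q p
    ... | tri< p<q _ _ | tri> _ _ p<q′ = cong (ordered p q) (Fin.<-irrelevant p<q p<q′)
    ... | tri≈ _ _ _   | tri≈ _ _ _    = refl
    ... | tri> _ _ q<p | tri< q<p′ _ _ = cong (ordered q p) (Fin.<-irrelevant q<p q<p′)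
    ... | tri< p<q _ _ | tri< _ _ p≮q  = ⊥-elim (p≮q p<q)
    ... | tri< _ p≢q _ | tri≈ _ q≡p _  = ⊥-elim (p≢q (sym q≡p))
    ... | tri≈ _ p≡q _ | tri< _ q≢p _  = ⊥-elim (q≢p (sym p≡q))
    ... | tri≈ _ p≡q _ | tri> _ q≢p _  = ⊥-elim (q≢p (sym p≡q))
    ... | tri> _ p≢q _ | tri≈ _ q≡p _  = ⊥-elim (p≢q (sym q≡p))
    ... | tri> _ _ q<p | tri> q≮p _ _  = ⊥-elim (q≮p q<p)

    colour-R : ∀ p q → p ≢ q → R (colour p q) (c p) (c q)
    colour-R p q p≢q with Fin.<-cmp p q
    ... | tri< p<q _ _ = proj₂ (edge p q (Fin.<⇒≢ p<q))
    ... | tri≈ _ p≡q _ = ⊥-elim (p≢q p≡q)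
    ... | tri> _ _ q<p = R-sym _ (proj₂ (edge q p (Fin.<⇒≢ q<p)))

  monochromatic-clique : ∀ {t r} → Fin k → RamseyProperty k t r → (c : Fin r → V) →
    (∀ p q → p ≢ q → ∃[ l ] R l (c p) (c q)) →
    ∃[ l ] ∃[ g ] ((∀ p q → g p ≡ g q → p ≡ q) × (∀ p q → p ≢ q → R l (c (g p)) (c (g q))))
  monochromatic-clique l₀ ramsey c edge =
    let l , g , g-injective , mono = ramsey colour colour-sym
    in  l , g , g-injective , λ p q p≢q →
          subst (λ l → R l (c (g p)) (c (g q))) (mono p q p≢q) (colour-R (g p) (g q) (p≢q ∘ g-injective p q))
    where open Colouring l₀ c edge

module _ {n : ℕ} (G : SimpleGraph n) (F : Multigraph) (k : ℕ) (1≤k : 1 ≤ k) (D : ℚ) (pD : Positive D)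
         (maxDeg : MaxDegreeAtMost G D) (H-free : ¬ ContainsSubdivision G F k) where
  open RichPairs G F k D pD maxDeg
  open Paths G

  RichLink⇒≢ : ∀ {x y} → RichLink x y → x ≢ y
  RichLink⇒≢ (_ , _ , _ , _ , x≢y , _) = x≢y

  𝒢Adj⇒RichLink : ∀ {v ℓ U U′} → 𝒢Adj G F k D pD v ℓ U U′ →
    RichLink (lookup (proj₁ U) ℓ) (lookup (proj₁ U′) ℓ) ⊎ RichLink (lookup (proj₁ U′) ℓ) (lookup (proj₁ U) ℓ)
  𝒢Adj⇒RichLink (inj₁ (_ , link)) = inj₁ link
  𝒢Adj⇒RichLink (inj₂ (_ , link)) = inj₂ link

  𝒢Adj-cliqueFree : ∀ v ℓ → CliqueFree (𝒢Adj G F k D pD v ℓ) (t F)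
  𝒢Adj-cliqueFree v ℓ (c , _ , c-adjacent) =
    H-free (Embedding.subdivision G F k 1≤k img img-injective connect)
    where
    img : Fin (t F) → Fin n
    img a = lookup (proj₁ (c a)) ℓ
    img-injective : ∀ a b → img a ≡ img b → a ≡ b
    img-injective a b eq = decidable-stable (a Fin.≟ b) λ a≢b →
      [ RichLink⇒≢ , (λ ba → RichLink⇒≢ ba ∘ sym) ]′ (𝒢Adj⇒RichLink {U = c a} {c b} (c-adjacent a b a≢b)) eq
    connect : ∀ a b → a ≢ b → ∀ S → length S ≤ vH F k → AvoidingPath S (2 * k ∸ 1) (img a) (img b)
    connect a b a≢b S |S|≤v with 𝒢Adj⇒RichLink {U = c a} {c b} (c-adjacent a b a≢b)
    ... | inj₁ ab = rich⇒avoidingPath S |S|≤v ab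
    ... | inj₂ ba = reverseAvoidingPath (rich⇒avoidingPath S |S|≤v ba)

  𝒢AdjAll⇒𝒢Adj : ∀ {v U U′} → 𝒢AdjAll G F k D pD v U U′ → ∃[ l ] 𝒢Adj G F k D pD v (suc l) U U′
  𝒢AdjAll⇒𝒢Adj (suc l , _ , adjacent) = l , adjacent

  𝒢AdjAll-cliqueFree : ∀ {r} → RamseyProperty k (t F) r → ∀ v → CliqueFree (𝒢AdjAll G F k D pD v) r
  𝒢AdjAll-cliqueFree ramsey v (c , c-injective , c-adjacent) =
    let l , g , g-injective , mono =
          monochromatic-clique (λ l → 𝒢Adj G F k D pD v (suc l)) (λ _ → Sum.swap) (Fin.fromℕ< 1≤k) ramsey c
            (λ p q p≢q → 𝒢AdjAll⇒𝒢Adj {U = c p} {c q} (c-adjacent p q p≢q))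
    in  𝒢Adj-cliqueFree v (suc l) (c ∘ g , (λ p q → g-injective p q ∘ c-injective (g p) (g q)) , mono)

-- The first part holds for ℓ = 0 too.
lemma4p4 : (k : ℕ) → 1 ≤ k → (F : Multigraph) →
    (K δ : ℚ) → (pK : Positive K) → (pδ : Positive δ) →
    {n : ℕ} → (G : SimpleGraph n) →
    MaxDegreeAtMost G (K ℚ.* δ) →
    ¬ ContainsSubdivision G F k →
    ((v : Fin n) → (ℓ : Fin (suc k)) → 1 ≤ toℕ ℓ →
       CliqueFree (𝒢Adj G F k (K ℚ.* δ) (posMul K δ pK pδ) v ℓ) (t F))
    ×
    ((r : ℕ) → IsRamseyNumber k (t F) r → (v : Fin n) →
       CliqueFree (𝒢AdjAll G F k (K ℚ.* δ) (posMul K δ pK pδ) v) r)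
lemma4p4 k 1≤k F K δ pK pδ G maxDeg H-free =
  (λ v ℓ _ → 𝒢Adj-cliqueFree G F k 1≤k (K ℚ.* δ) (posMul K δ pK pδ) maxDeg H-free v ℓ) ,
  (λ r (ramsey , _) → 𝒢AdjAll-cliqueFree G F k 1≤k (K ℚ.* δ) (posMul K δ pK pδ) maxDeg H-free ramsey)
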